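{- Let $G$ be a group and let $A\subseteq G$ be such that $\chi_A$ is founded on a valued tree of cosets which is linear, irreducible and infinite. Then $A$ is strongly generic but not uniformly strongly generic.
   Context: A valued tree of cosets of $G$ is $(T,\mathcal H,d,v)$ where $T\subseteq\omega^{<\omega}$ is a finitely branching tree with leaves $T_L$, $H_\eta\le G$, $d_\eta\in G$ ($\eta\in T$), with $H_\varnothing=G$; $H_{\eta^\frown i}=H_{\eta^\frown j}$ whenever both nodes are in $T$; $H_{\eta^\frown i}$ a proper finite-index subgroup of $H_\eta$; for non-leaves $\eta$, $d_\eta H_\eta$ is the disjoint union of the $d_{\eta^\frown i}H_{\eta^\frown i}$; every $g\in G$ lies in $d_\eta H_\eta$ for some leaf $\eta$; and $v:T_L\to\{0,1\}$. $f_T(g)$ is the unique leaf $\eta$ with $g\in d_\eta H_\eta$, and $\chi_A$ is founded on the tree if $\chi_A=v\circ f_T$. Linear: $H_\eta=A_{|\eta|}$ for a decreasing sequence $G=A_0\ge A_1\ge\dots$ of finite-index normal subgroups. Irreducible: every node $\eta$ such that $v$ is constant on the leaves extending $\eta$ is a leaf. $B\subseteq G$ is ($m$-)generic if ($m$) finitely many left translates cover $G$. $A$ is strongly generic if every non-empty set in the smallest family containing $A$ closed under finite unions, complements and left translations is generic; $A$ is uniformly strongly generic if for each Boolean term $\tau(X_1,\dots,X_n)$ there is $m_\tau$ with $\tau(g_1A,\dots,g_nA)$ empty or $m_\tau$-generic for all $g_i\in G$. -}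

module Defs where

open import Level using (Level; _⊔_; suc)
open import Algebra.Bundles using (Group)
open import Data.Nat using (ℕ; zero; _<_)
open import Data.Fin using (Fin)
open import Data.Bool using (Bool; true)
open import Data.List using (List; []; _∷ʳ_; _++_; length)
open import Data.List.Membership.Propositional using (_∈_)
open import Data.Product using (Σ; ∃; ∃-syntax; _×_; _,_)
open import Data.Sum using (_⊎_)
open import Data.Empty using (⊥)
open import Relation.Nullary using (¬_)
open import Relation.Binary.PropositionalEquality using (_≡_)
open import Function.Bundles using (_⇔_)

-- Nodes of a tree T ⊆ ω^{<ω} are lists of naturals; the i-th child of η is η ∷ʳ i.
Node : Set
Node = List ℕ

module _ {c ℓ : Level} (G : Group c ℓ) where
  open Group G

  Subset : Set (suc (c ⊔ ℓ))
  Subset = Carrier → Set (c ⊔ ℓ)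

  record Subgroup : Set (suc (c ⊔ ℓ)) where
    field
      mem   : Subset
      resp  : ∀ {x y} → x ≈ y → mem x → mem y
      ε-mem : mem ε
      ∙-mem : ∀ {x y} → mem x → mem y → mem (x ∙ y)
      ⁻¹-mem : ∀ {x} → mem x → mem (x ⁻¹)
  open Subgroup public

  InCoset : Carrier → Subgroup → Carrier → Set (c ⊔ ℓ)
  InCoset d H g = Σ Carrier λ h → mem H h × (g ≈ d ∙ h)

  _≤ₛ_ : Subgroup → Subgroup → Set (c ⊔ ℓ)
  K ≤ₛ H = ∀ x → mem K x → mem H x

  SameSubgroup : Subgroup → Subgroup → Set (c ⊔ ℓ)
  SameSubgroup K H = ∀ x → mem K x ⇔ mem H x

  -- K has finite index in H (K ≤ H assumed separately): finitely many
  -- elements of H whose cosets of K cover H.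
  FiniteIndexIn : Subgroup → Subgroup → Set (c ⊔ ℓ)
  FiniteIndexIn K H =
    Σ (List Carrier) λ ds → (∀ d → d ∈ ds → mem H d) ×
      (∀ h → mem H h → Σ Carrier λ d → d ∈ ds × InCoset d K h)

  ProperFiniteIndexSubgroup : Subgroup → Subgroup → Set (c ⊔ ℓ)
  ProperFiniteIndexSubgroup K H =
    K ≤ₛ H × FiniteIndexIn K H × (Σ Carrier λ h → mem H h × ¬ mem K h)

  IsWhole : Subgroup → Set (c ⊔ ℓ)
  IsWhole H = ∀ g → mem H g

  IsNormal : Subgroup → Set (c ⊔ ℓ)
  IsNormal H = ∀ g h → mem H h → mem H ((g ∙ h) ∙ g ⁻¹)

  record ValuedTree : Set (suc (c ⊔ ℓ)) where
    field
      T : Node → Set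
      H : Node → Subgroup
      d : Node → Carrier
      v : Node → Bool       -- only its values on leaves are relevant

    Leaf : Node → Set
    Leaf η = T η × (∀ i → ¬ T (η ∷ʳ i))

    NonLeaf : Node → Set
    NonLeaf η = T η × (Σ ℕ λ i → T (η ∷ʳ i))

    field
      root       : T []
      prefix     : ∀ η i → T (η ∷ʳ i) → T η
      finBranch  : ∀ η → Σ ℕ λ n → ∀ i → T (η ∷ʳ i) → i < n
      H-root     : IsWhole (H [])
      H-siblings : ∀ η i j → T (η ∷ʳ i) → T (η ∷ʳ j) →
                   SameSubgroup (H (η ∷ʳ i)) (H (η ∷ʳ j))
      H-child    : ∀ η i → T (η ∷ʳ i) →
                   ProperFiniteIndexSubgroup (H (η ∷ʳ i)) (H η)
      partition  : ∀ η → NonLeaf η → ∀ g →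
                   InCoset (d η) (H η) g ⇔
                   (Σ ℕ λ i → T (η ∷ʳ i) × InCoset (d (η ∷ʳ i)) (H (η ∷ʳ i)) g)
      disjoint   : ∀ η i j g → T (η ∷ʳ i) → T (η ∷ʳ j) →
                   InCoset (d (η ∷ʳ i)) (H (η ∷ʳ i)) g →
                   InCoset (d (η ∷ʳ j)) (H (η ∷ʳ j)) g → i ≡ j
      cover      : ∀ g → Σ Node λ η → Leaf η × InCoset (d η) (H η) g

  module _ (𝒯 : ValuedTree) where
    open ValuedTree 𝒯

    -- χ_A = v ∘ f_T : for the (unique) leaf η with g ∈ d_η H_η, g ∈ A iff v η = 1.
    FoundedOn : Subset → Set (c ⊔ ℓ)
    FoundedOn A = ∀ g η → Leaf η → InCoset (d η) (H η) g → (A g ⇔ (v η ≡ true))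

    Linear : Set (suc (c ⊔ ℓ))
    Linear = Σ (ℕ → Subgroup) λ As →
      IsWhole (As zero) ×
      (∀ n → As (Data.Nat.suc n) ≤ₛ As n) ×
      (∀ n → IsNormal (As n)) ×
      (∀ n → FiniteIndexIn (As n) (As zero)) ×
      (∀ η → T η → SameSubgroup (H η) (As (length η)))

    Irreducible : Set
    Irreducible = ∀ η → T η →
      (∀ ζ ζ' → Leaf (η ++ ζ) → Leaf (η ++ ζ') → v (η ++ ζ) ≡ v (η ++ ζ')) →
      Leaf η

    Infinite : Set
    Infinite = ¬ (Σ (List Node) λ L → ∀ η → T η → η ∈ L)

  Translate : Carrier → Subset → Subset
  Translate g B x = B (g ⁻¹ ∙ x)

  Generic : Subset → Set (c ⊔ ℓ)
  Generic B = Σ (List Carrier) λ gs → ∀ x → Σ Carrier λ g → g ∈ gs × Translate g B x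

  MGeneric : ℕ → Subset → Set (c ⊔ ℓ)
  MGeneric m B = Σ (Fin m → Carrier) λ gs → ∀ x → Σ (Fin m) λ k → Translate (gs k) B x

  NonEmpty : Subset → Set (c ⊔ ℓ)
  NonEmpty B = Σ Carrier B

  IsEmpty : Subset → Set (c ⊔ ℓ)
  IsEmpty B = ∀ x → ¬ B x

  -- The smallest family containing A and closed under finite unions,
  -- complements and left translations: its members are exactly the
  -- interpretations of the following generating expressions.
  data Gen : Set c where
    base  : Gen
    empty : Gen                  -- the empty union
    union : Gen → Gen → Gen
    compl : Gen → Gen
    translate : Carrier → Gen → Gen

  ⟦_⟧ᴳ : Gen → Subset → Subset
  ⟦ base ⟧ᴳ A = A
  ⟦ empty ⟧ᴳ A x = Level.Lift (c ⊔ ℓ) ⊥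
  ⟦ union s t ⟧ᴳ A x = ⟦ s ⟧ᴳ A x ⊎ ⟦ t ⟧ᴳ A x
  ⟦ compl s ⟧ᴳ A x = ¬ ⟦ s ⟧ᴳ A x
  ⟦ translate g s ⟧ᴳ A = Translate g (⟦ s ⟧ᴳ A)

  StronglyGeneric : Subset → Set (c ⊔ ℓ)
  StronglyGeneric A = ∀ (s : Gen) → NonEmpty (⟦ s ⟧ᴳ A) → Generic (⟦ s ⟧ᴳ A)

data BTerm (n : ℕ) : Set where
  var   : Fin n → BTerm n
  bot   : BTerm n
  _∪_   : BTerm n → BTerm n → BTerm n
  ∁_    : BTerm n → BTerm n

module _ {c ℓ : Level} (G : Group c ℓ) where
  open Group G

  ⟦_⟧ᴮ : ∀ {n} → BTerm n → (Fin n → Subset G) → Subset G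
  ⟦ var i ⟧ᴮ Xs = Xs i
  ⟦ bot ⟧ᴮ Xs x = Level.Lift (c ⊔ ℓ) ⊥
  ⟦ s ∪ t ⟧ᴮ Xs x = ⟦ s ⟧ᴮ Xs x ⊎ ⟦ t ⟧ᴮ Xs x
  ⟦ ∁ s ⟧ᴮ Xs x = ¬ ⟦ s ⟧ᴮ Xs x

  UniformlyStronglyGeneric : Subset G → Set (c ⊔ ℓ)
  UniformlyStronglyGeneric A =
    ∀ n (τ : BTerm n) → Σ ℕ λ m → ∀ (gs : Fin n → Carrier) →
      let S = ⟦ τ ⟧ᴮ (λ i → Translate G (gs i) A) in
      IsEmpty G S ⊎ MGeneric G m S

-- Since H_η = A_|η|, A is constant on g·A_d for d the depth of the leaf containing g. This local
-- constancy survives unions, complements and translations, and a non-empty locally constant set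
-- contains a coset of some finite-index Aₙ, so it is generic.
-- If A were uniformly strongly generic, with constant m for the sets A ∖ kA, refine a coset
-- m times, once per translate hⱼ, to reach a point c such that A is constant on every hⱼ⁻¹c·Aₙ;
-- since each step only descends to the leaves through a fixed set of coset representatives,
-- n depends on m alone. As c lies in some hⱼ(A ∖ kA), normality of Aₙ forces A ∖ kA = ∅ for all
-- k ∈ Aₙ. Then A is a union of Aₙ-cosets, irreducibility makes every node of depth n a leaf, and
-- the finitely branching tree is finite.
module Submission where

open import Defs
open import Level using (Level; lift) renaming (_⊔_ to _⊔ˡ_)
open import Algebra.Bundles using (Group)
import Algebra.Properties.Group as GroupProperties
open import Data.Bool using (true; _≟_)
open import Data.Bool.Properties using (⇔→≡)
open import Data.Empty using (⊥-elim)
open import Data.Fin using (Fin; zero; suc)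
open import Data.List using (List; []; _∷_; [_]; _++_; _∷ʳ_; length; map; concatMap; upTo)
open import Data.List.Extrema.Nat using (max; ⊥≤max; xs≤max)
open import Data.List.Membership.Propositional using (_∈_; lose)
open import Data.List.Membership.Propositional.Properties using (∈-map⁺; ∈-concatMap⁺; ∈-upTo⁺)
open import Data.List.Properties using (++-identityʳ; ∷ʳ-++; length-++)
open import Data.List.Relation.Unary.All using (lookup)
open import Data.List.Relation.Unary.Any using (here; there)
open import Data.Nat using (ℕ; zero; suc; _≤_; _<_; _+_; _⊔_; _≤′_; ≤′-refl; ≤′-step)
open import Data.Nat.GeneralisedArithmetic using (iterate)
open import Data.Nat.Properties using (≤-refl; ≤-trans; ≤⇒≤′; m≤m⊔n; m≤n⊔m; +-identityʳ; +-assoc)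
open import Data.Product using (_×_; Σ; ∃; _,_; proj₁; proj₂)
open import Data.Sum using (inj₁; inj₂)
open import Data.Sum.Function.Propositional using (_⊎-⇔_)
open import Data.Vec.Functional using () renaming (_∷_ to _∷ᶠ_; [] to []ᶠ)
open import Function using (_∘_)
open import Function.Bundles using (_⇔_; mk⇔; Equivalence)
open import Function.Properties.Equivalence using () renaming (sym to ⇔-sym; trans to ⇔-trans)
open import Function.Related.TypeIsomorphisms using (¬-cong-⇔)
open import Relation.Binary.PropositionalEquality as ≡ using (_≡_)
open import Relation.Nullary using (¬_)
open import Relation.Nullary.Decidable using (decidable-stable)

open Equivalence using (to; from)

module Cosets {c ℓ : Level} (G : Group c ℓ) where
  open Group G
  open GroupProperties G

  infix 4 _∼[_]_
  _∼[_]_ : Carrier → Subgroup G → Carrier → Set (c ⊔ˡ ℓ)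
  x ∼[ K ] y = mem K (x \\ y)

  module _ (K : Subgroup G) where

    ∼-reflexive : ∀ {x y} → x ≈ y → x ∼[ K ] y
    ∼-reflexive {x} x≈y = resp K (trans (sym (inverseˡ x)) (∙-congˡ x≈y)) (ε-mem K)

    ∼-refl : ∀ {x} → x ∼[ K ] x
    ∼-refl = ∼-reflexive refl

    ∼-sym : ∀ {x y} → x ∼[ K ] y → y ∼[ K ] x
    ∼-sym {x} {y} x∼y = resp K (⁻¹-anti-homo-\\ x y) (⁻¹-mem K x∼y)

    ∼-trans : ∀ {x y z} → x ∼[ K ] y → y ∼[ K ] z → x ∼[ K ] z
    ∼-trans {x} {y} {z} x∼y y∼z =
      resp K (trans (assoc _ _ _) (∙-congˡ (\\-leftDividesˡ y z))) (∙-mem K x∼y y∼z)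

    ∼-translate : ∀ g {x y} → x ∼[ K ] y → g ∙ x ∼[ K ] g ∙ y
    ∼-translate g {x} {y} = resp K (sym (begin
      (g ∙ x) ⁻¹ ∙ (g ∙ y)    ≈⟨ ∙-congʳ (⁻¹-anti-homo-∙ g x) ⟩
      x ⁻¹ ∙ g ⁻¹ ∙ (g ∙ y)   ≈⟨ assoc _ _ _ ⟩
      x ⁻¹ ∙ (g ⁻¹ ∙ (g ∙ y)) ≈⟨ ∙-congˡ (\\-leftDividesʳ g y) ⟩
      x ⁻¹ ∙ y                ∎))
      where open import Relation.Binary.Reasoning.Setoid setoid

    inCoset⇒∼ : ∀ {r g} → InCoset G r K g → r ∼[ K ] g
    inCoset⇒∼ {r} (h , h∈K , g≈rh) = resp K (sym (trans (∙-congˡ g≈rh) (\\-leftDividesʳ r h))) h∈K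

    ∼⇒inCoset : ∀ {r g} → r ∼[ K ] g → InCoset G r K g
    ∼⇒inCoset {r} {g} r∼g = r \\ g , r∼g , sym (\\-leftDividesˡ r g)

    module _ (normal : IsNormal G K) where

      normal⇒∼ : ∀ {k} x → mem K k → x ∼[ K ] k ∙ x
      normal⇒∼ {k} x k∈K =
        resp K (trans (assoc _ _ _) (∙-congˡ (∙-congˡ (⁻¹-involutive x)))) (normal (x ⁻¹) k k∈K)

      ∼⇒mem-// : ∀ {x y} → x ∼[ K ] y → mem K (y // x)
      ∼⇒mem-// {x} {y} x∼y = resp K (∙-congʳ (\\-leftDividesˡ x y)) (normal x (x \\ y) x∼y)

    coset⊆⇒generic : ∀ {W S x} → IsWhole G W → FiniteIndexIn G K W →
                     (∀ y → x ∼[ K ] y → S y) → Generic G S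
    coset⊆⇒generic {x = x} whole (reps , _ , covered) xK⊆S =
      map (_// x) reps , λ z →
        let r , r∈reps , z∈rK = covered z (whole z)
            x≈ : x ≈ (r // x) \\ r
            x≈ = sym (trans (∙-congʳ (⁻¹-anti-homo-// r x)) (//-rightDividesˡ r x))
        in r // x , ∈-map⁺ (_// x) r∈reps ,
           xK⊆S _ (∼-trans (∼-reflexive x≈) (∼-translate ((r // x) ⁻¹) (inCoset⇒∼ z∈rK)))

module LocalConstancy {c ℓ : Level} (G : Group c ℓ)
                      (As : ℕ → Subgroup G) (As-decreasing : ∀ n → _≤ₛ_ G (As (suc n)) (As n)) where
  open Group G
  open GroupProperties G
  open Cosets G

  As-antitone : ∀ {m n} → m ≤ n → _≤ₛ_ G (As n) (As m)
  As-antitone = antitone′ ∘ ≤⇒≤′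
    where
    antitone′ : ∀ {m n} → m ≤′ n → _≤ₛ_ G (As n) (As m)
    antitone′ ≤′-refl       _ x∈ = x∈
    antitone′ (≤′-step m≤n) _ x∈ = antitone′ m≤n _ (As-decreasing _ _ x∈)

  ConstantAround : Subset G → ℕ → Carrier → Set (c ⊔ˡ ℓ)
  ConstantAround S n x = ∀ y → x ∼[ As n ] y → S x ⇔ S y

  LocallyConstant : Subset G → Set (c ⊔ˡ ℓ)
  LocallyConstant S = ∀ x → ∃ λ n → ConstantAround S n x

  constantAround-transfer : ∀ {S m n x x′} → m ≤ n → ConstantAround S m x →
                            x ∼[ As m ] x′ → ConstantAround S n x′
  constantAround-transfer {m = m} m≤n const x∼x′ y x′∼y =
    ⇔-trans (⇔-sym (const _ x∼x′)) (const y (∼-trans (As m) x∼x′ (As-antitone m≤n _ x′∼y)))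

  locallyConstant-resp : ∀ {S x y} → LocallyConstant S → x ≈ y → S x → S y
  locallyConstant-resp {x = x} lc x≈y = to (proj₂ (lc x) _ (∼-reflexive (As (proj₁ (lc x))) x≈y))

  locallyConstant-⟦⟧ : ∀ {A} → LocallyConstant A → ∀ s → LocallyConstant (⟦_⟧ᴳ G s A)
  locallyConstant-⟦⟧ lc base = lc
  locallyConstant-⟦⟧ lc empty x = 0 , λ _ _ → mk⇔ (λ { (lift ()) }) (λ { (lift ()) })
  locallyConstant-⟦⟧ lc (union s t) x =
    let m , constˢ = locallyConstant-⟦⟧ lc s x
        n , constᵗ = locallyConstant-⟦⟧ lc t x
    in m ⊔ n , λ y x∼y → constˢ y (As-antitone (m≤m⊔n m n) _ x∼y)
                      ⊎-⇔ constᵗ y (As-antitone (m≤n⊔m m n) _ x∼y)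
  locallyConstant-⟦⟧ lc (compl s) x =
    let n , const = locallyConstant-⟦⟧ lc s x in n , λ y x∼y → ¬-cong-⇔ (const y x∼y)
  locallyConstant-⟦⟧ lc (translate g s) x =
    let n , const = locallyConstant-⟦⟧ lc s (g \\ x) in
    n , λ y x∼y → const (g \\ y) (∼-translate (As n) (g ⁻¹) x∼y)

  locallyConstant⇒stronglyGeneric : ∀ {A} → IsWhole G (As 0) →
    (∀ n → FiniteIndexIn G (As n) (As 0)) → LocallyConstant A → StronglyGeneric G A
  locallyConstant⇒stronglyGeneric whole finiteIndex lc s (x , x∈) =
    let n , const = locallyConstant-⟦⟧ lc s x in
    coset⊆⇒generic (As n) {W = As 0} whole (finiteIndex n) (λ y x∼y → to (const y x∼y) x∈)

  module Refinement {A : Subset G} (bound : ℕ → ℕ) (bound-inflationary : ∀ k → k ≤ bound k)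
    (constantPoint : ∀ k g → ∃ λ r → g ∼[ As k ] r × ConstantAround A (bound k) r) where

    iterate-inflationary : ∀ m k → k ≤ iterate bound k m
    iterate-inflationary zero    k = ≤-refl
    iterate-inflationary (suc m) k =
      ≤-trans (bound-inflationary k) (iterate-inflationary m (bound k))

    refine : ∀ m (hs : Fin m → Carrier) c k →
             ∃ λ c′ → c ∼[ As k ] c′ × ∀ j → ConstantAround A (iterate bound k m) (hs j \\ c′)
    refine zero    hs c k = c , ∼-refl (As k) , λ ()
    refine (suc m) hs c k =
      let h = hs zero
          r , h\\c∼r , constʳ = constantPoint k (h \\ c)
          c′ , hr∼c′ , constᶜ = refine m (hs ∘ suc) (h ∙ r) (bound k)
          c∼hr : c ∼[ As k ] h ∙ r
          c∼hr = ∼-trans (As k) (∼-reflexive (As k) (sym (\\-leftDividesˡ h c)))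
                                (∼-translate (As k) h h\\c∼r)
          r∼h\\c′ : r ∼[ As (bound k) ] h \\ c′
          r∼h\\c′ = ∼-trans (As (bound k)) (∼-reflexive (As (bound k)) (sym (\\-leftDividesʳ h r)))
                                           (∼-translate (As (bound k)) (h ⁻¹) hr∼c′)
      in c′ , ∼-trans (As k) c∼hr (As-antitone (bound-inflationary k) _ hr∼c′) , λ where
           zero    → constantAround-transfer (iterate-inflationary m (bound k)) constʳ r∼h\\c′
           (suc j) → constᶜ j

    difference : BTerm 2
    difference = ∁ ((∁ var zero) ∪ var (suc zero))

    usg⇒uniformlyConstant : (∀ n → IsNormal G (As n)) → (∀ {x y} → x ≈ y → A x → A y) →
      UniformlyStronglyGeneric G A → ∃ λ n → ∀ x y → x ∼[ As n ] y → A x → ¬ ¬ A y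
    usg⇒uniformlyConstant normal A-resp usg = n , uniformlyConstant
      where
      m = proj₁ (usg 2 difference)
      n = iterate bound 0 m

      ε\\x≈x : ∀ x → ε \\ x ≈ x
      ε\\x≈x x = trans (∙-congʳ ε⁻¹≈ε) (identityˡ x)

      A∖_A : Carrier → Subset G
      A∖ k A = ⟦_⟧ᴮ G difference (λ i → Translate G ((ε ∷ᶠ k ∷ᶠ []ᶠ) i) A)

      notGeneric : ∀ {k} → mem (As n) k → ¬ MGeneric G m (A∖ k A)
      notGeneric {k} k∈ (hs , covered) =
        let c′ , _ , const = refine m hs ε 0
            j , z∈ = covered c′
            z = hs j \\ c′
            Az⇔Ak\\z = const j (k \\ z) (normal⇒∼ (As n) (normal n) z (⁻¹-mem (As n) k∈))
        in z∈ (inj₁ λ Aε\\z → z∈ (inj₂ (to Az⇔Ak\\z (A-resp (ε\\x≈x z) Aε\\z))))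

      absorbs : ∀ {k} → mem (As n) k → ∀ z → A z → ¬ ¬ A (k \\ z)
      absorbs {k} k∈ z Az ¬Ak\\z with proj₂ (usg 2 difference) (ε ∷ᶠ k ∷ᶠ []ᶠ)
      ... | inj₁ isEmpty = isEmpty z λ where
        (inj₁ ¬Aε\\z) → ¬Aε\\z (A-resp (sym (ε\\x≈x z)) Az)
        (inj₂ Ak\\z)  → ¬Ak\\z Ak\\z
      ... | inj₂ generic = notGeneric k∈ generic

      uniformlyConstant : ∀ x y → x ∼[ As n ] y → A x → ¬ ¬ A y
      uniformlyConstant x y x∼y Ax ¬Ay =
        absorbs (∼⇒mem-// (As n) (normal n) (∼-sym (As n) x∼y)) x Ax
          (¬Ay ∘ A-resp (trans (∙-congʳ (⁻¹-anti-homo-// x y)) (//-rightDividesˡ x y)))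

module FinitelyBranchingTree (T : Node → Set) (prefix : ∀ η i → T (η ∷ʳ i) → T η)
                             (finBranch : ∀ η → Σ ℕ λ n → ∀ i → T (η ∷ʳ i) → i < n) where

  T-∷ʳ-++ : ∀ η i ζ → T (η ++ i ∷ ζ) → T ((η ∷ʳ i) ++ ζ)
  T-∷ʳ-++ η i ζ = ≡.subst T (≡.sym (∷ʳ-++ η i ζ))

  prefix-++ : ∀ η ζ → T (η ++ ζ) → T η
  prefix-++ η []      t = ≡.subst T (++-identityʳ η) t
  prefix-++ η (i ∷ ζ) t = prefix η i (prefix-++ (η ∷ʳ i) ζ (T-∷ʳ-++ η i ζ t))

  nodesWithin : ℕ → Node → List Node
  nodesWithin zero    η = [ η ]
  nodesWithin (suc k) η = η ∷ concatMap (λ i → nodesWithin k (η ∷ʳ i)) (upTo (proj₁ (finBranch η)))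

  module _ (n : ℕ) (shallow : ∀ η → T η → n ≤ length η → ∀ i → ¬ T (η ∷ʳ i)) where

    ∈-nodesWithin : ∀ k η ζ → T (η ++ ζ) → n ≤ length η + k → η ++ ζ ∈ nodesWithin k η
    ∈-nodesWithin k η [] _ _ = ≡.subst (_∈ nodesWithin k η) (≡.sym (++-identityʳ η)) (self k)
      where
      self : ∀ k → η ∈ nodesWithin k η
      self zero    = here ≡.refl
      self (suc k) = here ≡.refl
    ∈-nodesWithin zero η (i ∷ ζ) t n≤ =
      ⊥-elim (shallow η (prefix-++ η (i ∷ ζ) t) (≡.subst (n ≤_) (+-identityʳ _) n≤) i
                (prefix-++ (η ∷ʳ i) ζ (T-∷ʳ-++ η i ζ t)))
    ∈-nodesWithin (suc k) η (i ∷ ζ) t n≤ =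
      ≡.subst (_∈ nodesWithin (suc k) η) (∷ʳ-++ η i ζ)
        (there (∈-concatMap⁺ (λ i → nodesWithin k (η ∷ʳ i))
          (lose (∈-upTo⁺ (proj₂ (finBranch η) i (prefix-++ (η ∷ʳ i) ζ t′)))
                (∈-nodesWithin k (η ∷ʳ i) ζ t′ (≡.subst (n ≤_) length-shift n≤)))))
      where
      t′ = T-∷ʳ-++ η i ζ t
      length-shift : length η + suc k ≡ length (η ∷ʳ i) + k
      length-shift = ≡.sym (≡.trans (≡.cong (_+ k) (length-++ η)) (+-assoc (length η) 1 k))

    boundedDepth⇒finite : ∃ λ L → ∀ η → T η → η ∈ L
    boundedDepth⇒finite = nodesWithin n [] , λ η t → ∈-nodesWithin n [] η t ≤-refl

module _ {c ℓ : Level} (G : Group c ℓ) (𝒯 : ValuedTree G) where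
  open ValuedTree 𝒯
  open FinitelyBranchingTree T prefix finBranch

  inCoset-ancestor : ∀ η ζ {g} → T (η ++ ζ) →
                     InCoset G (d (η ++ ζ)) (H (η ++ ζ)) g → InCoset G (d η) (H η) g
  inCoset-ancestor η []      {g} _ = ≡.subst (λ ξ → InCoset G (d ξ) (H ξ) g) (++-identityʳ η)
  inCoset-ancestor η (i ∷ ζ) {g} t g∈ =
    from (partition η (prefix η i tηi , i , tηi) g) (i , tηi , inCoset-ancestor (η ∷ʳ i) ζ t′ g∈′)
    where
    t′  = T-∷ʳ-++ η i ζ t
    g∈′ = ≡.subst (λ ξ → InCoset G (d ξ) (H ξ) g) (≡.sym (∷ʳ-++ η i ζ)) g∈
    tηi = prefix-++ (η ∷ʳ i) ζ t′

module FoundedOnLinearTree {c ℓ : Level} (G : Group c ℓ) (A : Subset G) (𝒯 : ValuedTree G)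
  (founded : FoundedOn G 𝒯 A)
  (As : ℕ → Subgroup G) (whole : IsWhole G (As 0))
  (As-decreasing : ∀ n → _≤ₛ_ G (As (suc n)) (As n))
  (finiteIndex : ∀ n → FiniteIndexIn G (As n) (As 0))
  (H≈As : ∀ η → ValuedTree.T 𝒯 η → SameSubgroup G (ValuedTree.H 𝒯 η) (As (length η))) where
  open Group G
  open ValuedTree 𝒯
  open Cosets G
  open LocalConstancy G As As-decreasing

  depth : Carrier → ℕ
  depth g = length (proj₁ (cover g))

  constantAround-depth : ∀ g → ConstantAround A (depth g) g
  constantAround-depth g y g∼y =
    let η , leaf , g∈ = cover g
        g∼y′ = from (H≈As η (proj₁ leaf) _) g∼y
        y∈ = ∼⇒inCoset (H η) (∼-trans (H η) (inCoset⇒∼ (H η) g∈) g∼y′)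
    in ⇔-trans (founded g η leaf g∈) (⇔-sym (founded y η leaf y∈))

  A-locallyConstant : LocallyConstant A
  A-locallyConstant g = depth g , constantAround-depth g

  bound : ℕ → ℕ
  bound k = max k (map depth (proj₁ (finiteIndex k)))

  constantPoint : ∀ k g → ∃ λ r → g ∼[ As k ] r × ConstantAround A (bound k) r
  constantPoint k g =
    let r , r∈reps , g∈rAk = proj₂ (proj₂ (finiteIndex k)) g (whole g)
        depth≤bound = lookup (xs≤max k (map depth (proj₁ (finiteIndex k)))) (∈-map⁺ depth r∈reps)
    in r , ∼-sym (As k) (inCoset⇒∼ (As k) g∈rAk) ,
       constantAround-transfer depth≤bound (constantAround-depth r) (∼-refl (As (depth r)))

  open Refinement bound (λ k → ⊥≤max k (map depth (proj₁ (finiteIndex k)))) constantPoint public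

  deepNodesAreLeaves : Irreducible G 𝒯 → ∀ n → (∀ x y → x ∼[ As n ] y → A x → ¬ ¬ A y) →
                       ∀ η → T η → n ≤ length η → Leaf η
  deepNodesAreLeaves irreducible n uniformlyConstant η t n≤ = irreducible η t λ ζ ζ′ leaf leaf′ →
    ⇔→≡ (mk⇔ (valueTrue ζ ζ′ leaf leaf′) (valueTrue ζ′ ζ leaf′ leaf))
    where
    valueTrue : ∀ ζ ζ′ → Leaf (η ++ ζ) → Leaf (η ++ ζ′) → v (η ++ ζ) ≡ true → v (η ++ ζ′) ≡ true
    valueTrue ζ ζ′ leaf leaf′ vtrue =
      let p = d (η ++ ζ)
          p′ = d (η ++ ζ′)
          p∈ = ∼⇒inCoset (H (η ++ ζ)) (∼-refl (H (η ++ ζ)))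
          p′∈ = ∼⇒inCoset (H (η ++ ζ′)) (∼-refl (H (η ++ ζ′)))
          dη∼p  = inCoset⇒∼ (H η) (inCoset-ancestor G 𝒯 η ζ (proj₁ leaf) p∈)
          dη∼p′ = inCoset⇒∼ (H η) (inCoset-ancestor G 𝒯 η ζ′ (proj₁ leaf′) p′∈)
          p∼p′ = ∼-trans (H η) (∼-sym (H η) dη∼p) dη∼p′
          Ap = from (founded p (η ++ ζ) leaf p∈) vtrue
      in decidable-stable (_ ≟ true) λ v≢true →
           uniformlyConstant p p′ (As-antitone n≤ _ (to (H≈As η t _) p∼p′)) Ap
             (v≢true ∘ to (founded p′ (η ++ ζ′) leaf′ p′∈))

corollary4p15 : ∀ {c ℓ : Level} (G : Group c ℓ) (A : Subset G) (𝒯 : ValuedTree G) →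
                FoundedOn G 𝒯 A → Linear G 𝒯 → Irreducible G 𝒯 → Infinite G 𝒯 →
                StronglyGeneric G A × ¬ UniformlyStronglyGeneric G A
corollary4p15 G A 𝒯 founded (As , whole , As-decreasing , normal , finiteIndex , H≈As)
              irreducible infinite =
  locallyConstant⇒stronglyGeneric whole finiteIndex A-locallyConstant , λ usg →
    let n , uniformlyConstant =
          usg⇒uniformlyConstant normal (locallyConstant-resp A-locallyConstant) usg
        shallow η t n≤ = proj₂ (deepNodesAreLeaves irreducible n uniformlyConstant η t n≤)
    in infinite (boundedDepth⇒finite n shallow)
  where
  open ValuedTree 𝒯
  open LocalConstancy G As As-decreasing
  open FinitelyBranchingTree T prefix finBranch
  open FoundedOnLinearTree G A 𝒯 founded As whole As-decreasing finiteIndex H≈As
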